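{- Let $D$ be a deck of order $n$ and length $\ell$. If there exists a symbol $s$ with $m(s)=n$, then $\ell=\Delta_n=n^2-n+1$.
   Context: A deck consists of a finite set $S$ of symbols together with a finite collection $D$ of distinct cards, each card being a subset of $S$, satisfying: (D1) any two distinct cards have exactly one symbol in common; (D2) every symbol of $S$ lies on at least two cards; (D3) every card contains at least two symbols; (D4) all cards have the same cardinality $n$ (the order); (D5) $S$ is nonempty. $\ell=|S|$ is the length. For $s\in S$, the multiplicity $m(s)$ is the number of cards containing $s$. The fundamental number is $\Delta_n=n^2-n+1$. -}

module Defs where

open import Data.Nat using (ℕ; _≤_; _∸_; _+_; _*_)
open import Data.Fin using (Fin)
open import Data.Fin.Subset using (Subset; _∩_; ∣_∣)
open import Data.Vec using (tabulate; lookup)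
open import Relation.Binary.PropositionalEquality using (_≡_; _≢_)
open import Function.Definitions using (Injective)

-- A deck with symbol set S = Fin ℓ (so the length is ℓ) and c cards.
-- Cards are given as an indexed family of subsets of S; distinctness of
-- the cards is injectivity of the indexing.
record Deck (ℓ c n : ℕ) : Set where
  field
    card     : Fin c → Subset ℓ
    distinct : Injective _≡_ _≡_ card
    D1 : ∀ i j → i ≢ j → ∣ card i ∩ card j ∣ ≡ 1
    D2 : ∀ (s : Fin ℓ) → 2 ≤ ∣ tabulate (λ i → lookup (card i) s) ∣
    -- (D3) every card has at least two symbols
    D3 : ∀ i → 2 ≤ ∣ card i ∣
    D4 : ∀ i → ∣ card i ∣ ≡ n
    D5 : 1 ≤ ℓ

multiplicity : ∀ {ℓ c n} → Deck ℓ c n → Fin ℓ → ℕ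
multiplicity D s = ∣ tabulate (λ i → lookup (Deck.card D i) s) ∣

Δ : ℕ → ℕ
Δ n = n * n ∸ n + 1

-- Let m(s) = n.  The n cards through s pairwise meet only in s, so a symbol
-- t ≠ s lies on at most one of them.  It lies on at least one: if a card C
-- contains t but not s, then C meets each of the n cards through s in a
-- single symbol, and these n symbols are distinct, so they exhaust C.
-- Hence the pencil at s covers S exactly, each card contributing its n − 1
-- symbols besides s, and counting incidences gives n² = n + (ℓ − 1).
module Submission where

open import Defs
open import Data.Nat using (ℕ; zero; suc; _+_; _*_; _∸_; _≤_; _<_; z≤n; s≤s)
open import Data.Nat.Properties
open import Data.Fin using (Fin; zero; suc; punchIn)
import Data.Fin.Properties as Fin
open import Data.Fin.Subset using (Subset; _∩_; ∣_∣)
open import Data.Bool using (Bool; true; false; _∧_)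
open import Data.Vec using ([]; _∷_; tabulate; lookup)
open import Data.Vec.Properties using (lookup∘tabulate; lookup-zipWith)
open import Data.Vec.Functional using (Vector; replicate)
open import Data.Product using (∃; _,_; _×_)
open import Function using (_∘_)
open import Relation.Nullary using (yes; no; contradiction)
open import Relation.Binary.PropositionalEquality
  using (_≡_; _≢_; refl; sym; trans; cong; cong₂; subst; subst₂; module ≡-Reasoning)
open import Algebra.Properties.Semiring.Sum +-*-semiring
  using (sum; sum-syntax; sum-cong-≗; sum-remove; sum-replicate-zero; ∑-comm; *-distribˡ-sum; *-distribʳ-sum)
open import Algebra.Properties.CommutativeSemigroup *-commutativeSemigroup
  using (x∙yz≈y∙xz)

∑-ones : ∀ k → ∑[ i < k ] 1 ≡ k
∑-ones zero    = refl
∑-ones (suc k) = cong suc (∑-ones k)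

∑-mono-≤ : ∀ {k} {f g : Vector ℕ k} → (∀ i → f i ≤ g i) → sum f ≤ sum g
∑-mono-≤ {zero}  f≤g = z≤n
∑-mono-≤ {suc k} f≤g = +-mono-≤ (f≤g zero) (∑-mono-≤ (f≤g ∘ suc))

∑-mono-< : ∀ {k} {f g : Vector ℕ k} (j : Fin k) →
           (∀ i → f i ≤ g i) → f j < g j → sum f < sum g
∑-mono-< zero    f≤g fj<gj = +-mono-<-≤ fj<gj (∑-mono-≤ (f≤g ∘ suc))
∑-mono-< (suc j) f≤g fj<gj = +-mono-≤-< (f≤g zero) (∑-mono-< j (f≤g ∘ suc) fj<gj)

term≤∑ : ∀ {k} (f : Vector ℕ k) (i : Fin k) → f i ≤ sum f
term≤∑ f zero    = m≤m+n (f zero) _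
term≤∑ f (suc i) = ≤-trans (term≤∑ (f ∘ suc) i) (m≤n+m _ (f zero))

term+term≤∑ : ∀ {k} (f : Vector ℕ k) {i j : Fin k} → i ≢ j → f i + f j ≤ sum f
term+term≤∑ {suc k} f {zero}  {zero}  i≢j = contradiction refl i≢j
term+term≤∑ {suc k} f {zero}  {suc j} i≢j = +-monoʳ-≤ (f zero) (term≤∑ (f ∘ suc) j)
term+term≤∑ {suc k} f {suc i} {zero}  i≢j =
  subst (_≤ sum f) (+-comm (f zero) (f (suc i))) (+-monoʳ-≤ (f zero) (term≤∑ (f ∘ suc) i))
term+term≤∑ {suc k} f {suc i} {suc j} i≢j =
  ≤-trans (term+term≤∑ (f ∘ suc) (i≢j ∘ cong suc)) (m≤n+m _ (f zero))

∑-single : ∀ {k} (f : Vector ℕ k) (i : Fin k) → (∀ j → j ≢ i → f j ≡ 0) → sum f ≡ f i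
∑-single {suc k} f i others-zero = begin
  sum f                       ≡⟨ sum-remove {i = i} f ⟩
  f i + sum (f ∘ punchIn i)   ≡⟨ cong (f i +_) (sum-cong-≗ (λ j → others-zero _ (Fin.punchInᵢ≢i i j))) ⟩
  f i + sum (replicate k 0)   ≡⟨ cong (f i +_) (sum-replicate-zero k) ⟩
  f i + 0                     ≡⟨ +-identityʳ (f i) ⟩
  f i                         ∎
  where open ≡-Reasoning

∑-single-ones : ∀ {k} (f : Vector ℕ k) (i : Fin k) → (∀ j → j ≢ i → f j ≡ 1) →
                sum f ≡ f i + (k ∸ 1)
∑-single-ones {suc k} f i others-one = begin
  sum f                       ≡⟨ sum-remove {i = i} f ⟩
  f i + sum (f ∘ punchIn i)   ≡⟨ cong (f i +_) (sum-cong-≗ (λ j → others-one _ (Fin.punchInᵢ≢i i j))) ⟩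
  f i + ∑[ j < k ] 1          ≡⟨ cong (f i +_) (∑-ones k) ⟩
  f i + k                     ∎
  where open ≡-Reasoning

∑-positive⇒∃ : ∀ {k} (f : Vector ℕ k) → 0 < sum f → ∃ λ i → 0 < f i
∑-positive⇒∃ {suc k} f 0<∑ with f zero in eq
... | suc _ = zero , subst (0 <_) (sym eq) (s≤s z≤n)
... | zero  = let i , 0<fi = ∑-positive⇒∃ (f ∘ suc) 0<∑ in suc i , 0<fi

𝟙 : Bool → ℕ
𝟙 true  = 1
𝟙 false = 0

𝟙-∧ : ∀ a b → 𝟙 (a ∧ b) ≡ 𝟙 a * 𝟙 b
𝟙-∧ true  true  = refl
𝟙-∧ true  false = refl
𝟙-∧ false b     = refl

𝟙-idem : ∀ b → 𝟙 b * 𝟙 b ≡ 𝟙 b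
𝟙-idem true  = refl
𝟙-idem false = refl

𝟙-positive : ∀ {b} → 0 < 𝟙 b → b ≡ true
𝟙-positive {true} _ = refl

𝟙*𝟙-positive : ∀ a b → 0 < 𝟙 a * 𝟙 b → a ≡ true × b ≡ true
𝟙*𝟙-positive true true _ = refl , refl

∣p∣≡∑𝟙 : ∀ {k} (p : Subset k) → ∣ p ∣ ≡ ∑[ i < k ] 𝟙 (lookup p i)
∣p∣≡∑𝟙 []          = refl
∣p∣≡∑𝟙 (true  ∷ p) = cong suc (∣p∣≡∑𝟙 p)
∣p∣≡∑𝟙 (false ∷ p) = ∣p∣≡∑𝟙 p

∣tabulate∣≡∑𝟙 : ∀ {k} (g : Fin k → Bool) → ∣ tabulate g ∣ ≡ ∑[ i < k ] 𝟙 (g i)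
∣tabulate∣≡∑𝟙 g = trans (∣p∣≡∑𝟙 (tabulate g)) (sum-cong-≗ (cong 𝟙 ∘ lookup∘tabulate g))

∣p∩q∣≡∑𝟙*𝟙 : ∀ {k} (p q : Subset k) → ∣ p ∩ q ∣ ≡ ∑[ i < k ] (𝟙 (lookup p i) * 𝟙 (lookup q i))
∣p∩q∣≡∑𝟙*𝟙 p q = trans (∣p∣≡∑𝟙 (p ∩ q))
  (sum-cong-≗ (λ i → trans (cong 𝟙 (lookup-zipWith _∧_ i p q)) (𝟙-∧ (lookup p i) (lookup q i))))

m+n≤1⇒m*n≡0 : ∀ m n → m + n ≤ 1 → m * n ≡ 0
m+n≤1⇒m*n≡0 zero    n       _ = refl
m+n≤1⇒m*n≡0 (suc m) zero    _ = *-zeroʳ m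
m+n≤1⇒m*n≡0 (suc m) (suc n) (s≤s m+1+n≤0) = contradiction (n≤0⇒n≡0 m+1+n≤0) (m+1+n≢0 m)

module Incidence {ℓ c n} (D : Deck ℓ c n) where
  open Deck D

  χ : Fin c → Fin ℓ → ℕ
  χ i t = 𝟙 (lookup (card i) t)

  card-size : ∀ i → ∑[ t < ℓ ] χ i t ≡ n
  card-size i = trans (sym (∣p∣≡∑𝟙 (card i))) (D4 i)

  cards-meet : ∀ i j → i ≢ j → ∑[ t < ℓ ] (χ i t * χ j t) ≡ 1
  cards-meet i j i≢j = trans (sym (∣p∩q∣≡∑𝟙*𝟙 (card i) (card j))) (D1 i j i≢j)

  multiplicity≡∑χ : ∀ t → multiplicity D t ≡ ∑[ i < c ] χ i t
  multiplicity≡∑χ t = ∣tabulate∣≡∑𝟙 (λ i → lookup (card i) t)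

module Pencil {ℓ c n} (D : Deck ℓ c n) (s : Fin ℓ) (m[s]≡n : multiplicity D s ≡ n) where
  open Deck D
  open Incidence D

  pencil : Fin ℓ → ℕ
  pencil t = ∑[ i < c ] (χ i s * χ i t)

  cards-through-s : ∑[ i < c ] χ i s ≡ n
  cards-through-s = trans (sym (multiplicity≡∑χ s)) m[s]≡n

  pencil-centre : pencil s ≡ n
  pencil-centre = trans (sum-cong-≗ (λ i → 𝟙-idem (lookup (card i) s))) cards-through-s

  pencil-sum : ∑[ t < ℓ ] pencil t ≡ n * n
  pencil-sum = begin
    ∑[ t < ℓ ] ∑[ i < c ] (χ i s * χ i t)   ≡⟨ ∑-comm (λ t i → χ i s * χ i t) ⟩
    ∑[ i < c ] ∑[ t < ℓ ] (χ i s * χ i t)   ≡⟨ sum-cong-≗ (λ i → sym (*-distribˡ-sum (χ i s) (χ i))) ⟩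
    ∑[ i < c ] (χ i s * ∑[ t < ℓ ] χ i t)   ≡⟨ sum-cong-≗ (λ i → cong (χ i s *_) (card-size i)) ⟩
    ∑[ i < c ] (χ i s * n)                  ≡⟨ sym (*-distribʳ-sum n (λ i → χ i s)) ⟩
    (∑[ i < c ] χ i s) * n                  ≡⟨ cong (_* n) cards-through-s ⟩
    n * n                                   ∎
    where open ≡-Reasoning

  double-count : ∀ C → ∑[ u < ℓ ] (χ C u * pencil u) ≡ ∑[ i < c ] (χ i s * ∑[ u < ℓ ] (χ C u * χ i u))
  double-count C = begin
    ∑[ u < ℓ ] (χ C u * ∑[ i < c ] (χ i s * χ i u))   ≡⟨ sum-cong-≗ (λ u → *-distribˡ-sum (χ C u) (λ i → χ i s * χ i u)) ⟩
    ∑[ u < ℓ ] ∑[ i < c ] (χ C u * (χ i s * χ i u))   ≡⟨ ∑-comm (λ u i → χ C u * (χ i s * χ i u)) ⟩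
    ∑[ i < c ] ∑[ u < ℓ ] (χ C u * (χ i s * χ i u))   ≡⟨ sum-cong-≗ (λ i → sum-cong-≗ (λ u → x∙yz≈y∙xz (χ C u) (χ i s) (χ i u))) ⟩
    ∑[ i < c ] ∑[ u < ℓ ] (χ i s * (χ C u * χ i u))   ≡⟨ sum-cong-≗ (λ i → sym (*-distribˡ-sum (χ i s) (λ u → χ C u * χ i u))) ⟩
    ∑[ i < c ] (χ i s * ∑[ u < ℓ ] (χ C u * χ i u))   ∎
    where open ≡-Reasoning

  pencil-positive⇒≡1 : ∀ t → t ≢ s → 0 < pencil t → pencil t ≡ 1
  pencil-positive⇒≡1 t t≢s 0<pencil[t] with ∑-positive⇒∃ (λ i → χ i s * χ i t) 0<pencil[t]
  ... | i , 0<term with 𝟙*𝟙-positive (lookup (card i) s) (lookup (card i) t) 0<term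
  ... | i∋s , i∋t =
    trans (∑-single (λ j → χ j s * χ j t) i (λ j j≢i → m+n≤1⇒m*n≡0 (χ j s) (χ j t) (meets-i j j≢i)))
          (cong₂ (λ a b → 𝟙 a * 𝟙 b) i∋s i∋t)
    where
    open ≤-Reasoning
    meets-i : ∀ j → j ≢ i → χ j s + χ j t ≤ 1
    meets-i j j≢i = begin
      χ j s + χ j t                     ≡⟨ cong₂ _+_ (sym (+-identityʳ (χ j s))) (sym (+-identityʳ (χ j t))) ⟩
      1 * χ j s + 1 * χ j t             ≡⟨ cong₂ (λ a b → 𝟙 a * χ j s + 𝟙 b * χ j t) (sym i∋s) (sym i∋t) ⟩
      χ i s * χ j s + χ i t * χ j t     ≤⟨ term+term≤∑ (λ u → χ i u * χ j u) (t≢s ∘ sym) ⟩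
      ∑[ u < ℓ ] (χ i u * χ j u)        ≡⟨ cards-meet i j (j≢i ∘ sym) ⟩
      1                                 ∎

  pencil-≤1 : ∀ t → t ≢ s → pencil t ≤ 1
  pencil-≤1 t t≢s with pencil t in eq
  ... | zero  = z≤n
  ... | suc _ = ≤-reflexive (trans (sym eq) (pencil-positive⇒≡1 t t≢s (subst (0 <_) (sym eq) (s≤s z≤n))))

  -- A card C avoiding s meets each of the n cards through s once, and only at
  -- points covered by the pencil: n = ∑_{u ∈ C} pencil u ≤ |C| = n, with
  -- equality only if every point of C is covered.
  card-avoiding-s-covered : ∀ C t → lookup (card C) s ≡ false → lookup (card C) t ≡ true →
                            0 < pencil t
  card-avoiding-s-covered C t C∌s C∋t = n≢0⇒n>0 λ pencil[t]≡0 → <-irrefl refl (begin-strict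
    n                                  ≡⟨ sym cards-through-s ⟩
    ∑[ i < c ] χ i s                   ≡⟨ sum-cong-≗ meets-once ⟨
    ∑[ i < c ] (χ i s * ∑[ u < ℓ ] (χ C u * χ i u))   ≡⟨ double-count C ⟨
    ∑[ u < ℓ ] (χ C u * pencil u)      <⟨ ∑-mono-< t covered-at-most-once (missed pencil[t]≡0) ⟩
    ∑[ u < ℓ ] χ C u                   ≡⟨ card-size C ⟩
    n                                  ∎)
    where
    open ≤-Reasoning
    meets-once : ∀ i → χ i s * ∑[ u < ℓ ] (χ C u * χ i u) ≡ χ i s
    meets-once i with lookup (card i) s in i∋s
    ... | false = refl
    ... | true  = cong (1 *_) (cards-meet C i λ { refl → contradiction (trans (sym C∌s) i∋s) λ () })
    covered-at-most-once : ∀ u → χ C u * pencil u ≤ χ C u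
    covered-at-most-once u with u Fin.≟ s
    ... | yes refl = subst (λ b → 𝟙 b * pencil u ≤ 𝟙 b) (sym C∌s) z≤n
    ... | no u≢s   = ≤-trans (*-monoʳ-≤ (χ C u) (pencil-≤1 u u≢s)) (≤-reflexive (*-identityʳ (χ C u)))
    missed : pencil t ≡ 0 → χ C t * pencil t < χ C t
    missed pencil[t]≡0 = subst₂ (λ b p → 𝟙 b * p < 𝟙 b) (sym C∋t) (sym pencil[t]≡0) (s≤s z≤n)

  pencil-covers : ∀ t → t ≢ s → 0 < pencil t
  pencil-covers t t≢s with ∑-positive⇒∃ (λ i → χ i t) (≤-trans (s≤s z≤n) (subst (2 ≤_) (multiplicity≡∑χ t) (D2 t)))
  ... | C , 0<χ[C,t] with 𝟙-positive 0<χ[C,t] | lookup (card C) s in C[s]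
  ... | C∋t | true  = ≤-trans (subst₂ (λ a b → 0 < 𝟙 a * 𝟙 b) (sym C[s]) (sym C∋t) (s≤s z≤n))
                              (term≤∑ (λ i → χ i s * χ i t) C)
  ... | C∋t | false = card-avoiding-s-covered C t C[s] C∋t

  pencil-off-centre : ∀ t → t ≢ s → pencil t ≡ 1
  pencil-off-centre t t≢s = pencil-positive⇒≡1 t t≢s (pencil-covers t t≢s)

  n*n≡n+[ℓ∸1] : n * n ≡ n + (ℓ ∸ 1)
  n*n≡n+[ℓ∸1] = begin
    n * n               ≡⟨ pencil-sum ⟨
    ∑[ t < ℓ ] pencil t ≡⟨ ∑-single-ones pencil s pencil-off-centre ⟩
    pencil s + (ℓ ∸ 1)  ≡⟨ cong (_+ (ℓ ∸ 1)) pencil-centre ⟩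
    n + (ℓ ∸ 1)         ∎
    where open ≡-Reasoning

mainTheorem6 : ∀ {ℓ c n} (D : Deck ℓ c n) →
    ∃ (λ (s : Fin ℓ) → multiplicity D s ≡ n) → ℓ ≡ Δ n
mainTheorem6 {ℓ} {n = n} D (s , m[s]≡n) = begin
  ℓ                     ≡⟨ m∸n+n≡m (Deck.D5 D) ⟨
  ℓ ∸ 1 + 1             ≡⟨ cong (_+ 1) (m+n∸m≡n n (ℓ ∸ 1)) ⟨
  n + (ℓ ∸ 1) ∸ n + 1   ≡⟨ cong (λ m → m ∸ n + 1) (Pencil.n*n≡n+[ℓ∸1] D s m[s]≡n) ⟨
  n * n ∸ n + 1         ∎
  where open ≡-Reasoning
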